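{- Let $\mathcal{C}$ be a monoidal dagger category. The equivalence between Frobenius monoids in $\mathcal{C}$ and strong Frobenius monads on $\mathcal{C}$ given by $B\mapsto -\otimes B$ and $T\mapsto T(I)$ restricts to an equivalence between special Frobenius monoids and special strong Frobenius monads.
   Context: A monoidal dagger category is a monoidal category with an identity-on-objects contravariant involutive functor $f\mapsto f^\dagger$ with $(f\otimes g)^\dagger=f^\dagger\otimes g^\dagger$ and unitary coherence isomorphisms. A Frobenius monoid is a monoid $(B,m,e)$ with $(\mathrm{id}\otimes m)\circ(m^\dagger\otimes\mathrm{id})=(m\otimes\mathrm{id})\circ(\mathrm{id}\otimes m^\dagger)$ (modulo associators); it is special if $m\circ m^\dagger=\mathrm{id}_B$. A Frobenius monad is a monad $(T,\mu,\eta)$ with $T(f^\dagger)=T(f)^\dagger$ and $T(\mu_A)\circ\mu^\dagger_{T(A)}=\mu_{T(A)}\circ T(\mu_A^\dagger)$; it is special if $\mu_A\circ\mu_A^\dagger=\mathrm{id}_{T(A)}$ for all $A$. A strong monad has a natural $\mathrm{st}_{A,B}\colon A\otimes T(B)\to T(A\otimes B)$ with $\mathrm{st}\circ\alpha=T(\alpha)\circ\mathrm{st}\circ(\mathrm{id}\otimes\mathrm{st})$, $T(\lambda)\circ\mathrm{st}=\lambda$, $\mathrm{st}\circ(\mathrm{id}\otimes\mu)=\mu\circ T(\mathrm{st})\circ\mathrm{st}$, $\mathrm{st}\circ(\mathrm{id}\otimes\eta)=\eta$; a strong Frobenius monad is a Frobenius monad that is strong with all $\mathrm{st}$ unitary;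 its morphisms are morphisms of strong monads. For a Frobenius monoid $B$, $-\otimes B$ has $\mu_A=\mathrm{id}_A\otimes m$, $\eta_A=\mathrm{id}_A\otimes e$ and strength given by associators; for a strong monad $T$, $T(I)$ has multiplication $\mu_I\circ T(\rho_{T(I)})\circ\mathrm{st}_{T(I),I}$ and unit $\eta_I$. These assignments form an equivalence between Frobenius monoids (with monoid homomorphisms) and strong Frobenius monads. -}

module Defs where

open import Level using (Level; _⊔_) renaming (suc to lsuc)
open import Relation.Binary using (IsEquivalence)

record Category (o ℓ e : Level) : Set (lsuc (o ⊔ ℓ ⊔ e)) where
  infixr 9 _∘_
  infix  4 _≈_
  infixr 4 _⇒_
  field
    Obj  : Set o
    _⇒_  : Obj → Obj → Set ℓ
    _≈_  : ∀ {A B} → A ⇒ B → A ⇒ B → Set e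
    id   : ∀ {A} → A ⇒ A
    _∘_  : ∀ {A B C} → B ⇒ C → A ⇒ B → A ⇒ C
    ≈-equiv   : ∀ {A B} → IsEquivalence (_≈_ {A} {B})
    ∘-resp-≈  : ∀ {A B C} {f f′ : B ⇒ C} {g g′ : A ⇒ B} →
                f ≈ f′ → g ≈ g′ → f ∘ g ≈ f′ ∘ g′
    assoc     : ∀ {A B C D} {f : A ⇒ B} {g : B ⇒ C} {h : C ⇒ D} →
                (h ∘ g) ∘ f ≈ h ∘ (g ∘ f)
    identityˡ : ∀ {A B} {f : A ⇒ B} → id ∘ f ≈ f
    identityʳ : ∀ {A B} {f : A ⇒ B} → f ∘ id ≈ f

record Monoidal {o ℓ e : Level} (C : Category o ℓ e) : Set (o ⊔ ℓ ⊔ e) where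
  open Category C
  infixr 10 _⊗₀_ _⊗₁_
  field
    _⊗₀_ : Obj → Obj → Obj
    _⊗₁_ : ∀ {A B X Y} → A ⇒ B → X ⇒ Y → A ⊗₀ X ⇒ B ⊗₀ Y
    unit : Obj
    ⊗-identity     : ∀ {A B} → id {A} ⊗₁ id {B} ≈ id
    ⊗-homomorphism : ∀ {A B X Y Z W} {f : A ⇒ B} {g : B ⇒ X} {h : Y ⇒ Z} {k : Z ⇒ W} →
                     (g ∘ f) ⊗₁ (k ∘ h) ≈ (g ⊗₁ k) ∘ (f ⊗₁ h)
    ⊗-resp-≈       : ∀ {A B X Y} {f f′ : A ⇒ B} {g g′ : X ⇒ Y} →
                     f ≈ f′ → g ≈ g′ → f ⊗₁ g ≈ f′ ⊗₁ g′
    α⇒ : ∀ {A B X} → (A ⊗₀ B) ⊗₀ X ⇒ A ⊗₀ (B ⊗₀ X)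
    α⇐ : ∀ {A B X} → A ⊗₀ (B ⊗₀ X) ⇒ (A ⊗₀ B) ⊗₀ X
    λ⇒ : ∀ {A} → unit ⊗₀ A ⇒ A
    λ⇐ : ∀ {A} → A ⇒ unit ⊗₀ A
    ρ⇒ : ∀ {A} → A ⊗₀ unit ⇒ A
    ρ⇐ : ∀ {A} → A ⇒ A ⊗₀ unit
    α-isoˡ : ∀ {A B X} → α⇐ {A} {B} {X} ∘ α⇒ ≈ id
    α-isoʳ : ∀ {A B X} → α⇒ {A} {B} {X} ∘ α⇐ ≈ id
    λ-isoˡ : ∀ {A} → λ⇐ {A} ∘ λ⇒ ≈ id
    λ-isoʳ : ∀ {A} → λ⇒ {A} ∘ λ⇐ ≈ id
    ρ-isoˡ : ∀ {A} → ρ⇐ {A} ∘ ρ⇒ ≈ id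
    ρ-isoʳ : ∀ {A} → ρ⇒ {A} ∘ ρ⇐ ≈ id
    α-natural : ∀ {A A′ B B′ X X′} {f : A ⇒ A′} {g : B ⇒ B′} {h : X ⇒ X′} →
                α⇒ ∘ ((f ⊗₁ g) ⊗₁ h) ≈ (f ⊗₁ (g ⊗₁ h)) ∘ α⇒
    λ-natural : ∀ {A B} {f : A ⇒ B} → λ⇒ ∘ (id {unit} ⊗₁ f) ≈ f ∘ λ⇒
    ρ-natural : ∀ {A B} {f : A ⇒ B} → ρ⇒ ∘ (f ⊗₁ id {unit}) ≈ f ∘ ρ⇒
    triangle  : ∀ {A B} → (id {A} ⊗₁ λ⇒ {B}) ∘ α⇒ {A} {unit} {B} ≈ ρ⇒ {A} ⊗₁ id {B}
    pentagon  : ∀ {A B X Y} →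
                (id {A} ⊗₁ α⇒ {B} {X} {Y}) ∘ α⇒ {A} {B ⊗₀ X} {Y} ∘ (α⇒ {A} {B} {X} ⊗₁ id {Y})
                ≈ α⇒ {A} {B} {X ⊗₀ Y} ∘ α⇒ {A ⊗₀ B} {X} {Y}

record Dagger {o ℓ e : Level} (C : Category o ℓ e) : Set (o ⊔ ℓ ⊔ e) where
  open Category C
  infix 11 _†
  field
    _† : ∀ {A B} → A ⇒ B → B ⇒ A
    †-identity     : ∀ {A} → id {A} † ≈ id
    †-homomorphism : ∀ {A B X} {f : A ⇒ B} {g : B ⇒ X} → (g ∘ f) † ≈ f † ∘ g †
    †-involutive   : ∀ {A B} {f : A ⇒ B} → f † † ≈ f
    †-resp-≈       : ∀ {A B} {f g : A ⇒ B} → f ≈ g → f † ≈ g †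

record IsMonoidalDagger {o ℓ e : Level} (C : Category o ℓ e)
                        (M : Monoidal C) (D : Dagger C) : Set (o ⊔ ℓ ⊔ e) where
  open Category C
  open Monoidal M
  open Dagger D
  field
    †-⊗     : ∀ {A B X Y} {f : A ⇒ B} {g : X ⇒ Y} → (f ⊗₁ g) † ≈ f † ⊗₁ g †
    α-unitary : ∀ {A B X} → α⇒ {A} {B} {X} † ≈ α⇐
    λ-unitary : ∀ {A} → λ⇒ {A} † ≈ λ⇐
    ρ-unitary : ∀ {A} → ρ⇒ {A} † ≈ ρ⇐

record MonoidalDaggerCategory (o ℓ e : Level) : Set (lsuc (o ⊔ ℓ ⊔ e)) where
  field
    category : Category o ℓ e
    monoidal : Monoidal category
    dagger   : Dagger category
    isMonoidalDagger : IsMonoidalDagger category monoidal dagger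
  open Category category public
  open Monoidal monoidal public
  open Dagger dagger public
  open IsMonoidalDagger isMonoidalDagger public

module _ {o ℓ e : Level} (𝒞 : MonoidalDaggerCategory o ℓ e) where
  open MonoidalDaggerCategory 𝒞

  record FrobeniusMonoid : Set (o ⊔ ℓ ⊔ e) where
    field
      Carrier : Obj
      mult    : Carrier ⊗₀ Carrier ⇒ Carrier
      munit   : unit ⇒ Carrier
      mult-assoc : mult ∘ (mult ⊗₁ id) ≈ mult ∘ (id ⊗₁ mult) ∘ α⇒
      mult-unitˡ : mult ∘ (munit ⊗₁ id) ≈ λ⇒
      mult-unitʳ : mult ∘ (id ⊗₁ munit) ≈ ρ⇒
      frobenius  : (id ⊗₁ mult) ∘ α⇒ ∘ (mult † ⊗₁ id)
                   ≈ (mult ⊗₁ id) ∘ α⇐ ∘ (id ⊗₁ mult †)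

  IsSpecialMonoid : FrobeniusMonoid → Set e
  IsSpecialMonoid B = mult ∘ mult † ≈ id
    where open FrobeniusMonoid B

  record StrongFrobeniusMonad : Set (o ⊔ ℓ ⊔ e) where
    field
      T₀ : Obj → Obj
      T₁ : ∀ {A B} → A ⇒ B → T₀ A ⇒ T₀ B
      T-identity     : ∀ {A} → T₁ (id {A}) ≈ id
      T-homomorphism : ∀ {A B X} {f : A ⇒ B} {g : B ⇒ X} → T₁ (g ∘ f) ≈ T₁ g ∘ T₁ f
      T-resp-≈       : ∀ {A B} {f g : A ⇒ B} → f ≈ g → T₁ f ≈ T₁ g
      μ : ∀ A → T₀ (T₀ A) ⇒ T₀ A
      η : ∀ A → A ⇒ T₀ A
      μ-natural : ∀ {A B} {f : A ⇒ B} → μ B ∘ T₁ (T₁ f) ≈ T₁ f ∘ μ A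
      η-natural : ∀ {A B} {f : A ⇒ B} → η B ∘ f ≈ T₁ f ∘ η A
      μ-assoc   : ∀ {A} → μ A ∘ T₁ (μ A) ≈ μ A ∘ μ (T₀ A)
      μ-unitˡ   : ∀ {A} → μ A ∘ T₁ (η A) ≈ id
      μ-unitʳ   : ∀ {A} → μ A ∘ η (T₀ A) ≈ id
      T-† : ∀ {A B} {f : A ⇒ B} → T₁ (f †) ≈ (T₁ f) †
      T-frobenius : ∀ {A} → T₁ (μ A) ∘ μ (T₀ A) † ≈ μ (T₀ A) ∘ T₁ (μ A †)
      st : ∀ A B → A ⊗₀ T₀ B ⇒ T₀ (A ⊗₀ B)
      st-natural : ∀ {A A′ B B′} {f : A ⇒ A′} {g : B ⇒ B′} →
                   st A′ B′ ∘ (f ⊗₁ T₁ g) ≈ T₁ (f ⊗₁ g) ∘ st A B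
      st-α : ∀ {A B X} → st (A ⊗₀ B) X ∘ α⇐
                         ≈ T₁ α⇐ ∘ st A (B ⊗₀ X) ∘ (id ⊗₁ st B X)
      st-λ : ∀ {A} → T₁ λ⇒ ∘ st unit A ≈ λ⇒
      st-μ : ∀ {A B} → st A B ∘ (id ⊗₁ μ B) ≈ μ (A ⊗₀ B) ∘ T₁ (st A B) ∘ st A (T₀ B)
      st-η : ∀ {A B} → st A B ∘ (id ⊗₁ η B) ≈ η (A ⊗₀ B)
      st-unitaryˡ : ∀ {A B} → st A B † ∘ st A B ≈ id
      st-unitaryʳ : ∀ {A B} → st A B ∘ st A B † ≈ id

  IsSpecialMonad : StrongFrobeniusMonad → Set (o ⊔ e)
  IsSpecialMonad T = ∀ A → μ A ∘ μ A † ≈ id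
    where open StrongFrobeniusMonad T

  -- B ↦ - ⊗ B : multiplication μ_A = id_A ⊗ m (modulo the associator).
  tensorMonad-μ : (B : FrobeniusMonoid) → ∀ A →
    (A ⊗₀ FrobeniusMonoid.Carrier B) ⊗₀ FrobeniusMonoid.Carrier B ⇒ A ⊗₀ FrobeniusMonoid.Carrier B
  tensorMonad-μ B A = (id ⊗₁ mult) ∘ α⇒
    where open FrobeniusMonoid B

  IsSpecialTensorMonad : FrobeniusMonoid → Set (o ⊔ e)
  IsSpecialTensorMonad B = ∀ A → tensorMonad-μ B A ∘ tensorMonad-μ B A † ≈ id

  -- T ↦ T(I) : multiplication μ_I ∘ T(ρ_{T(I)}) ∘ st_{T(I),I}, unit η_I.
  TI-mult : (T : StrongFrobeniusMonad) →
    StrongFrobeniusMonad.T₀ T unit ⊗₀ StrongFrobeniusMonad.T₀ T unit ⇒ StrongFrobeniusMonad.T₀ T unit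
  TI-mult T = μ unit ∘ T₁ (ρ⇒ {T₀ unit}) ∘ st (T₀ unit) unit
    where open StrongFrobeniusMonad T

  IsSpecialTI : StrongFrobeniusMonad → Set e
  IsSpecialTI T = TI-mult T ∘ TI-mult T † ≈ id

{-# OPTIONS --safe #-}
module Submission where

-- Specialness says that a multiplication is a coisometry (f ∘ f† = id). Both
-- transported multiplications, (id ⊗ m) ∘ α and μ_I ∘ T(ρ) ∘ st, are composites of
-- coisometries: the coherence isomorphisms and the strength are unitary, and
-- coisometries are stable under composition, tensoring and dagger-preserving functors.

open import Level using (Level)
open import Data.Product using (_×_; _,_)
open import Relation.Binary using (Setoid; IsEquivalence)
import Relation.Binary.Reasoning.Setoid as SetoidReasoning
open import Defs

module DaggerCategory {o ℓ e : Level} (C : Category o ℓ e) (D : Dagger C) where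
  open Category C
  open Dagger D
  open module ≈ {A B : Obj} = IsEquivalence (≈-equiv {A} {B}) using (refl; sym; trans)

  hom-setoid : Obj → Obj → Setoid ℓ e
  hom-setoid A B = record { Carrier = A ⇒ B ; _≈_ = _≈_ ; isEquivalence = ≈-equiv }

  IsCoisometry : ∀ {A B} → A ⇒ B → Set e
  IsCoisometry f = f ∘ f † ≈ id

  id-coisometry : ∀ {A} → IsCoisometry (id {A})
  id-coisometry = trans identityˡ †-identity

  inverse-adjoint⇒coisometry : ∀ {A B} {f : A ⇒ B} {g : B ⇒ A} →
    f † ≈ g → f ∘ g ≈ id → IsCoisometry f
  inverse-adjoint⇒coisometry f†≈g f∘g≈id = trans (∘-resp-≈ refl f†≈g) f∘g≈id

  ∘-coisometry : ∀ {A B X} {f : A ⇒ B} {g : B ⇒ X} →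
    IsCoisometry f → IsCoisometry g → IsCoisometry (g ∘ f)
  ∘-coisometry {f = f} {g} f-co g-co = begin
    (g ∘ f) ∘ (g ∘ f) †    ≈⟨ ∘-resp-≈ refl †-homomorphism ⟩
    (g ∘ f) ∘ (f † ∘ g †)  ≈⟨ assoc ⟩
    g ∘ (f ∘ (f † ∘ g †))  ≈⟨ ∘-resp-≈ refl (sym assoc) ⟩
    g ∘ ((f ∘ f †) ∘ g †)  ≈⟨ ∘-resp-≈ refl (trans (∘-resp-≈ f-co refl) identityˡ) ⟩
    g ∘ g †                ≈⟨ g-co ⟩
    id                     ∎
    where open SetoidReasoning (hom-setoid _ _)

module MonoidalDagger {o ℓ e : Level} (𝒞 : MonoidalDaggerCategory o ℓ e) where
  open MonoidalDaggerCategory 𝒞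
  open DaggerCategory category dagger public
  open ≈ using (refl; sym; trans)

  ⊗-coisometry : ∀ {A B X Y} {f : A ⇒ B} {g : X ⇒ Y} →
    IsCoisometry f → IsCoisometry g → IsCoisometry (f ⊗₁ g)
  ⊗-coisometry {f = f} {g} f-co g-co = begin
    (f ⊗₁ g) ∘ (f ⊗₁ g) †      ≈⟨ ∘-resp-≈ refl †-⊗ ⟩
    (f ⊗₁ g) ∘ (f † ⊗₁ g †)    ≈⟨ sym ⊗-homomorphism ⟩
    (f ∘ f †) ⊗₁ (g ∘ g †)     ≈⟨ ⊗-resp-≈ f-co g-co ⟩
    id ⊗₁ id                   ≈⟨ ⊗-identity ⟩
    id                         ∎
    where open SetoidReasoning (hom-setoid _ _)

  α⇒-coisometry : ∀ {A B X} → IsCoisometry (α⇒ {A} {B} {X})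
  α⇒-coisometry = inverse-adjoint⇒coisometry α-unitary α-isoʳ

  ρ⇒-coisometry : ∀ {A} → IsCoisometry (ρ⇒ {A})
  ρ⇒-coisometry = inverse-adjoint⇒coisometry ρ-unitary ρ-isoʳ

  module _ (T : StrongFrobeniusMonad 𝒞) where
    open StrongFrobeniusMonad T

    T₁-coisometry : ∀ {A B} {f : A ⇒ B} → IsCoisometry f → IsCoisometry (T₁ f)
    T₁-coisometry {f = f} f-co = begin
      T₁ f ∘ T₁ f †     ≈⟨ ∘-resp-≈ refl (sym T-†) ⟩
      T₁ f ∘ T₁ (f †)   ≈⟨ sym T-homomorphism ⟩
      T₁ (f ∘ f †)      ≈⟨ T-resp-≈ f-co ⟩
      T₁ id             ≈⟨ T-identity ⟩
      id                ∎
      where open SetoidReasoning (hom-setoid _ _)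

corollaryA4 : ∀ {o ℓ e : Level} (𝒞 : MonoidalDaggerCategory o ℓ e) →
    ((B : FrobeniusMonoid 𝒞) → IsSpecialMonoid 𝒞 B → IsSpecialTensorMonad 𝒞 B)
    × ((T : StrongFrobeniusMonad 𝒞) → IsSpecialMonad 𝒞 T → IsSpecialTI 𝒞 T)
corollaryA4 𝒞 = special-tensor-monad , special-TI
  where
  open MonoidalDagger 𝒞
  open StrongFrobeniusMonad using (st-unitaryʳ)

  special-tensor-monad : (B : FrobeniusMonoid 𝒞) → IsSpecialMonoid 𝒞 B → IsSpecialTensorMonad 𝒞 B
  special-tensor-monad _ mult-co _ =
    ∘-coisometry α⇒-coisometry (⊗-coisometry id-coisometry mult-co)

  special-TI : (T : StrongFrobeniusMonad 𝒞) → IsSpecialMonad 𝒞 T → IsSpecialTI 𝒞 T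
  special-TI T μ-co =
    ∘-coisometry (∘-coisometry (st-unitaryʳ T) (T₁-coisometry T ρ⇒-coisometry)) (μ-co _)
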